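{- Let $\pi=\pi_1\cdots\pi_n$ be a permutation of $[n]$ and $G_\pi$ its grid graph (defined in the context). Let $2\le i\le n-1$ and $(a,b,c)=(\pi_{i-1},\pi_i,\pi_{i+1})$. Then the number of vertices of degree $4$ in column $i$ (i.e. among the vertices $(i,s)$, $1\le s\le b$) equals $\max\{0,\min(a,c,b-1)-1\}$.
   Context: The grid graph $G_\pi$ of a permutation $\pi=\pi_1\cdots\pi_n$ of $[n]$ has vertex set $\{(i,j):1\le i\le n,\ 1\le j\le \pi_i\}$; two vertices $(i,j),(i',j')$ are adjacent iff either $i=i'$ and $|j-j'|=1$, or $|i-i'|=1$ and $j=j'$. -}

module Defs where

open import Data.Nat using (ℕ; zero; suc; _+_; _∸_; _≤_; _<_; _≟_; _≤?_; _⊔_; _⊓_)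
open import Data.Nat.Properties using ()
open import Data.List using (List; []; _∷_; length; filter; map; concatMap; upTo)
open import Data.Product using (_×_; _,_; proj₁; proj₂)
open import Data.Sum using (_⊎_)
open import Relation.Nullary using (Dec; yes; no; ¬_)
open import Relation.Nullary.Decidable using (_×-dec_; _⊎-dec_)
open import Relation.Binary.PropositionalEquality using (_≡_)

-- A permutation π = π₁ ⋯ πₙ of [n] = {1,…,n}, represented as a function
-- ℕ → ℕ of which only the values at 1,…,n matter (1-indexed).
IsPermutation : (n : ℕ) → (ℕ → ℕ) → Set
IsPermutation n π =
  (∀ i → 1 ≤ i → i ≤ n → (1 ≤ π i × π i ≤ n)) ×
  (∀ i j → 1 ≤ i → i ≤ n → 1 ≤ j → j ≤ n → π i ≡ π j → i ≡ j)

range1 : ℕ → List ℕ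
range1 m = map suc (upTo m)

IsVertex : (n : ℕ) → (ℕ → ℕ) → ℕ × ℕ → Set
IsVertex n π (i , j) = (1 ≤ i × i ≤ n) × (1 ≤ j × j ≤ π i)

vertices : (n : ℕ) → (ℕ → ℕ) → List (ℕ × ℕ)
vertices n π = concatMap (λ i → map (λ j → (i , j)) (range1 (π i))) (range1 n)

AbsDiff1 : ℕ → ℕ → Set
AbsDiff1 x y = (x ≡ suc y) ⊎ (y ≡ suc x)

absDiff1? : ∀ x y → Dec (AbsDiff1 x y)
absDiff1? x y = (x ≟ suc y) ⊎-dec (y ≟ suc x)

Adjacent : ℕ × ℕ → ℕ × ℕ → Set
Adjacent (i , j) (i' , j') = (i ≡ i' × AbsDiff1 j j') ⊎ (AbsDiff1 i i' × j ≡ j')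

adjacent? : ∀ u v → Dec (Adjacent u v)
adjacent? (i , j) (i' , j') =
  ((i ≟ i') ×-dec absDiff1? j j') ⊎-dec (absDiff1? i i' ×-dec (j ≟ j'))

degree : (n : ℕ) → (ℕ → ℕ) → ℕ × ℕ → ℕ
degree n π v = length (filter (λ w → adjacent? v w) (vertices n π))

deg4InColumn : (n : ℕ) → (ℕ → ℕ) → ℕ → ℕ
deg4InColumn n π i =
  length (filter (λ s → degree n π (i , s) ≟ 4) (range1 (π i)))

{-# OPTIONS --safe #-}
-- A vertex (i , s) is adjacent only to vertices in columns i - 1, i and i + 1, with at most one
-- neighbour on each side. For an interior column it therefore has degree 4 exactly when
-- s ≤ π (i - 1), 2 ≤ s, s < π i and s ≤ π (i + 1), that is when 2 ≤ s ≤ K with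
-- K = min (π (i - 1), π (i + 1), π i - 1) ≤ π i; there are K ∸ 1 such s, and the truncated
-- subtraction makes the 0 ⊔ _ of the statement redundant.
module Submission where

open import Defs
open import Algebra.Properties.CommutativeSemigroup using (interchange)
open import Data.Bool using (true; false)
open import Data.Empty using (⊥-elim)
open import Data.List using (List; []; _∷_; _++_; [_]; length; filter; map; concatMap; upTo)
open import Data.List.Properties using (filter-++; length-++; map-++; concatMap-++; ++-identityʳ; upTo-∷ʳ)
open import Data.Nat using (ℕ; zero; suc; _+_; _∸_; _⊓_; _⊔_; _≤_; _<_; z≤n; s≤s; >-nonZero; _≟_; _≤?_; _<?_)
open import Data.Nat.Properties
open import Data.Product using (_×_; _,_; proj₁; proj₂)
open import Data.Sum using (_⊎_; inj₁; inj₂)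
import Data.Sum as Sum
open import Function using (_∘_)
open import Level using (Level)
open import Relation.Binary.PropositionalEquality using (_≡_; refl; sym; trans; cong; cong₂; module ≡-Reasoning)
open import Relation.Nullary using (Dec; yes; no; ¬_; _because_)
open import Relation.Nullary.Decidable using (_×-dec_; _⊎-dec_)
open import Relation.Unary using (Pred; Decidable)
open ≡-Reasoning

private
  variable
    a p : Level
    A B : Set a
    P Q R S : Set p

𝟙 : Dec P → ℕ
𝟙 (true because _) = 1
𝟙 (false because _) = 0

𝟙-yes : (p? : Dec P) → P → 𝟙 p? ≡ 1
𝟙-yes (yes _) _  = refl
𝟙-yes (no ¬p) pf = ⊥-elim (¬p pf)

𝟙-no : (p? : Dec P) → ¬ P → 𝟙 p? ≡ 0
𝟙-no (no _)   _  = refl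
𝟙-no (yes pf) ¬p = ⊥-elim (¬p pf)

𝟙-cong : (p? : Dec P) (q? : Dec Q) → (P → Q) → (Q → P) → 𝟙 p? ≡ 𝟙 q?
𝟙-cong (yes pf) q? to _    = sym (𝟙-yes q? (to pf))
𝟙-cong (no ¬p)  q? _  from = sym (𝟙-no q? (¬p ∘ from))

𝟙-⊎ : (p? : Dec P) (q? : Dec Q) → ¬ (P × Q) → 𝟙 (p? ⊎-dec q?) ≡ 𝟙 p? + 𝟙 q?
𝟙-⊎ (yes pf) (yes qf) disjoint = ⊥-elim (disjoint (pf , qf))
𝟙-⊎ (yes _)  (no _)   _        = refl
𝟙-⊎ (no _)   (yes _)  _        = refl
𝟙-⊎ (no _)   (no _)   _        = refl

𝟙-sum≡4 : (p? : Dec P) (q? : Dec Q) (r? : Dec R) (s? : Dec S) →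
          𝟙 (𝟙 p? + 𝟙 q? + 𝟙 r? + 𝟙 s? ≟ 4) ≡ 𝟙 (p? ×-dec q? ×-dec r? ×-dec s?)
𝟙-sum≡4 (yes _) (yes _) (yes _) (yes _) = refl
𝟙-sum≡4 (yes _) (yes _) (yes _) (no _)  = refl
𝟙-sum≡4 (yes _) (yes _) (no _)  (yes _) = refl
𝟙-sum≡4 (yes _) (yes _) (no _)  (no _)  = refl
𝟙-sum≡4 (yes _) (no _)  (yes _) (yes _) = refl
𝟙-sum≡4 (yes _) (no _)  (yes _) (no _)  = refl
𝟙-sum≡4 (yes _) (no _)  (no _)  (yes _) = refl
𝟙-sum≡4 (yes _) (no _)  (no _)  (no _)  = refl
𝟙-sum≡4 (no _)  (yes _) (yes _) (yes _) = refl
𝟙-sum≡4 (no _)  (yes _) (yes _) (no _)  = refl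
𝟙-sum≡4 (no _)  (yes _) (no _)  (yes _) = refl
𝟙-sum≡4 (no _)  (yes _) (no _)  (no _)  = refl
𝟙-sum≡4 (no _)  (no _)  (yes _) (yes _) = refl
𝟙-sum≡4 (no _)  (no _)  (yes _) (no _)  = refl
𝟙-sum≡4 (no _)  (no _)  (no _)  (yes _) = refl
𝟙-sum≡4 (no _)  (no _)  (no _)  (no _)  = refl

∑ : ℕ → (ℕ → ℕ) → ℕ
∑ zero    h = 0
∑ (suc m) h = ∑ m h + h (suc m)

∑-cong : ∀ m {h g : ℕ → ℕ} → (∀ {j} → 1 ≤ j → j ≤ m → h j ≡ g j) → ∑ m h ≡ ∑ m g
∑-cong zero    _  = refl
∑-cong (suc m) eq = cong₂ _+_ (∑-cong m (λ 1≤j j≤m → eq 1≤j (m≤n⇒m≤1+n j≤m))) (eq (s≤s z≤n) ≤-refl)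

∑-zero : ∀ m {h : ℕ → ℕ} → (∀ {j} → 1 ≤ j → j ≤ m → h j ≡ 0) → ∑ m h ≡ 0
∑-zero zero    _  = refl
∑-zero (suc m) eq = cong₂ _+_ (∑-zero m (λ 1≤j j≤m → eq 1≤j (m≤n⇒m≤1+n j≤m))) (eq (s≤s z≤n) ≤-refl)

∑-+ : ∀ m (h g : ℕ → ℕ) → ∑ m (λ j → h j + g j) ≡ ∑ m h + ∑ m g
∑-+ zero    h g = refl
∑-+ (suc m) h g = begin
  ∑ m (λ j → h j + g j) + (h (suc m) + g (suc m)) ≡⟨ cong (_+ (h (suc m) + g (suc m))) (∑-+ m h g) ⟩
  ∑ m h + ∑ m g + (h (suc m) + g (suc m))         ≡⟨ interchange +-commutativeSemigroup (∑ m h) (∑ m g) (h (suc m)) (g (suc m)) ⟩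
  ∑ m h + h (suc m) + (∑ m g + g (suc m))         ∎

∑-split : ∀ m r (h : ℕ → ℕ) → ∑ (m + r) h ≡ ∑ m h + ∑ r (λ j → h (m + j))
∑-split m zero    h = trans (cong (λ k → ∑ k h) (+-identityʳ m)) (sym (+-identityʳ (∑ m h)))
∑-split m (suc r) h = begin
  ∑ (m + suc r) h                                       ≡⟨ cong (λ k → ∑ k h) (+-suc m r) ⟩
  ∑ (m + r) h + h (suc (m + r))                         ≡⟨ cong₂ _+_ (∑-split m r h) (cong h (sym (+-suc m r))) ⟩
  ∑ m h + ∑ r (λ j → h (m + j)) + h (m + suc r)         ≡⟨ +-assoc (∑ m h) _ _ ⟩
  ∑ m h + (∑ r (λ j → h (m + j)) + h (m + suc r))       ∎

∑-𝟙-≡ : ∀ m {x} → 1 ≤ x → ∑ m (λ j → 𝟙 (j ≟ x)) ≡ 𝟙 (x ≤? m)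
∑-𝟙-≡ zero    {x} 1≤x = sym (𝟙-no (x ≤? 0) (<⇒≱ 1≤x))
∑-𝟙-≡ (suc m) {x} 1≤x = begin
  ∑ m (λ j → 𝟙 (j ≟ x)) + 𝟙 (suc m ≟ x) ≡⟨ cong (_+ 𝟙 (suc m ≟ x)) (∑-𝟙-≡ m 1≤x) ⟩
  𝟙 (x ≤? m) + 𝟙 (suc m ≟ x)            ≡⟨ 𝟙-⊎ (x ≤? m) (suc m ≟ x) (λ (x≤m , 1+m≡x) → <⇒≱ (≤-reflexive 1+m≡x) x≤m) ⟨
  𝟙 (x ≤? m ⊎-dec suc m ≟ x)            ≡⟨ 𝟙-cong _ (x ≤? suc m) (λ { (inj₁ x≤m)   → m≤n⇒m≤1+n x≤m
                                                                 ; (inj₂ 1+m≡x) → ≤-reflexive (sym 1+m≡x) })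
                                                   (Sum.map m<1+n⇒m≤n sym ∘ m≤n⇒m<n∨m≡n) ⟩
  𝟙 (x ≤? suc m)                        ∎

∑-𝟙-≡suc : ∀ m {s} → s ≤ m → ∑ m (λ j → 𝟙 (s ≟ suc j)) ≡ 𝟙 (2 ≤? s)
∑-𝟙-≡suc m {zero}        _   = ∑-zero m (λ {j} _ _ → 𝟙-no (0 ≟ suc j) (λ ()))
∑-𝟙-≡suc m {suc zero}    _   = ∑-zero m (λ 1≤j _ → 𝟙-no _ (<⇒≢ 1≤j ∘ suc-injective))
∑-𝟙-≡suc m {suc (suc s)} s≤m = begin
  ∑ m (λ j → 𝟙 (suc (suc s) ≟ suc j)) ≡⟨ ∑-cong m (λ _ _ → 𝟙-cong _ _ (sym ∘ suc-injective) (cong suc ∘ sym)) ⟩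
  ∑ m (λ j → 𝟙 (j ≟ suc s))           ≡⟨ ∑-𝟙-≡ m (s≤s z≤n) ⟩
  𝟙 (suc s ≤? m)                      ≡⟨ 𝟙-yes _ (≤-trans (n≤1+n _) s≤m) ⟩
  1                                   ∎

∑-𝟙-×-≤ : ∀ {m K} {U : Pred ℕ p} (U? : Decidable U) → K ≤ m →
        ∑ m (λ s → 𝟙 (U? s ×-dec s ≤? K)) ≡ ∑ K (λ s → 𝟙 (U? s))
∑-𝟙-×-≤ {K = K} {U} U? K≤m with m≤n⇒∃[o]m+o≡n K≤m
... | r , refl = begin
  ∑ (K + r) h                          ≡⟨ ∑-split K r h ⟩
  ∑ K h + ∑ r (λ j → h (K + j))        ≡⟨ cong₂ _+_ (∑-cong K (λ _ s≤K → 𝟙-cong _ _ proj₁ (_, s≤K)))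
                                                   (∑-zero r (λ {j} 1≤j _ → 𝟙-no (h? (K + j)) (<⇒≱ (m<m+n K 1≤j) ∘ proj₂))) ⟩
  ∑ K (λ s → 𝟙 (U? s)) + 0             ≡⟨ +-identityʳ _ ⟩
  ∑ K (λ s → 𝟙 (U? s))                 ∎
  where
  h? : ∀ s → Dec (U s × s ≤ K)
  h? s = U? s ×-dec s ≤? K
  h : ℕ → ℕ
  h = 𝟙 ∘ h?

∑-𝟙-2≤ : ∀ m → ∑ m (λ s → 𝟙 (2 ≤? s)) ≡ m ∸ 1
∑-𝟙-2≤ zero          = refl
∑-𝟙-2≤ (suc zero)    = refl
∑-𝟙-2≤ (suc (suc m)) = begin
  ∑ (suc m) (λ s → 𝟙 (2 ≤? s)) + 𝟙 (2 ≤? suc (suc m)) ≡⟨ cong₂ _+_ (∑-𝟙-2≤ (suc m)) (𝟙-yes (2 ≤? suc (suc m)) (s≤s (s≤s z≤n))) ⟩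
  m + 1                                               ≡⟨ +-comm m 1 ⟩
  suc m                                               ∎

range1-suc : ∀ m → range1 (suc m) ≡ range1 m ++ [ suc m ]
range1-suc m = begin
  map suc (upTo (suc m))   ≡⟨ cong (map suc) (upTo-∷ʳ m) ⟨
  map suc (upTo m ++ [ m ]) ≡⟨ map-++ suc (upTo m) [ m ] ⟩
  range1 m ++ [ suc m ]    ∎

module _ {P : Pred A p} (P? : Decidable P) where

  length-filter-++ : ∀ xs ys → length (filter P? (xs ++ ys)) ≡ length (filter P? xs) + length (filter P? ys)
  length-filter-++ xs ys = trans (cong length (filter-++ P? xs ys)) (length-++ (filter P? xs))

  length-filter-map : ∀ (f : B → A) (xs : List B) → length (filter P? (map f xs)) ≡ length (filter (P? ∘ f) xs)
  length-filter-map f []       = refl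
  length-filter-map f (x ∷ xs) with P? (f x)
  ... | yes _ = cong suc (length-filter-map f xs)
  ... | no _  = length-filter-map f xs

  count-concatMap-range1 : ∀ (F : ℕ → List A) m →
                           length (filter P? (concatMap F (range1 m))) ≡ ∑ m (λ k → length (filter P? (F k)))
  count-concatMap-range1 F zero    = refl
  count-concatMap-range1 F (suc m) = begin
    length (filter P? (concatMap F (range1 (suc m))))
      ≡⟨ cong (length ∘ filter P?) (trans (cong (concatMap F) (range1-suc m)) (concatMap-++ F (range1 m) [ suc m ])) ⟩
    length (filter P? (concatMap F (range1 m) ++ F (suc m) ++ []))
      ≡⟨ length-filter-++ (concatMap F (range1 m)) _ ⟩
    length (filter P? (concatMap F (range1 m))) + length (filter P? (F (suc m) ++ []))
      ≡⟨ cong₂ _+_ (count-concatMap-range1 F m) (cong (length ∘ filter P?) (++-identityʳ (F (suc m)))) ⟩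
    ∑ m (λ k → length (filter P? (F k))) + length (filter P? (F (suc m)))
      ∎

module _ {P : Pred ℕ p} (P? : Decidable P) where

  count-range1 : ∀ m → length (filter P? (range1 m)) ≡ ∑ m (λ j → 𝟙 (P? j))
  count-range1 zero    = refl
  count-range1 (suc m) = begin
    length (filter P? (range1 (suc m)))                        ≡⟨ cong (length ∘ filter P?) (range1-suc m) ⟩
    length (filter P? (range1 m ++ [ suc m ]))                 ≡⟨ length-filter-++ P? (range1 m) [ suc m ] ⟩
    length (filter P? (range1 m)) + length (filter P? [ suc m ]) ≡⟨ cong₂ _+_ (count-range1 m) (length-filter-[ suc m ]) ⟩
    ∑ m (λ j → 𝟙 (P? j)) + 𝟙 (P? (suc m))                        ∎
    where
    length-filter-[_] : ∀ x → length (filter P? [ x ]) ≡ 𝟙 (P? x)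
    length-filter-[ x ] with P? x
    ... | yes _ = refl
    ... | no _  = refl

neighboursIn : (ℕ → ℕ) → ℕ × ℕ → ℕ → ℕ
neighboursIn π v k = ∑ (π k) (λ j → 𝟙 (adjacent? v (k , j)))

degree≡∑-neighboursIn : ∀ n π v → degree n π v ≡ ∑ n (neighboursIn π v)
degree≡∑-neighboursIn n π v = begin
  length (filter (adjacent? v) (concatMap column (range1 n)))  ≡⟨ count-concatMap-range1 (adjacent? v) column n ⟩
  ∑ n (λ k → length (filter (adjacent? v) (column k)))         ≡⟨ ∑-cong n (λ {k} _ _ → count-column k) ⟩
  ∑ n (neighboursIn π v)                                        ∎
  where
  column : ℕ → List (ℕ × ℕ)
  column k = map (k ,_) (range1 (π k))
  count-column : ∀ k → length (filter (adjacent? v) (column k)) ≡ neighboursIn π v k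
  count-column k = trans (length-filter-map (adjacent? v) (k ,_) (range1 (π k)))
                         (count-range1 (adjacent? v ∘ (k ,_)) (π k))

AbsDiff1-irrefl : ∀ x → ¬ AbsDiff1 x x
AbsDiff1-irrefl x (inj₁ x≡1+x) = 1+n≢n (sym x≡1+x)
AbsDiff1-irrefl x (inj₂ x≡1+x) = 1+n≢n (sym x≡1+x)

adjacent-columns : ∀ {i k s j} → Adjacent (i , s) (k , j) → i ≤ suc k × k ≤ suc i
adjacent-columns (inj₁ (refl , _))      = n≤1+n _ , n≤1+n _
adjacent-columns (inj₂ (inj₁ refl , _)) = ≤-refl , m≤n⇒m≤1+n (n≤1+n _)
adjacent-columns (inj₂ (inj₂ refl , _)) = m≤n⇒m≤1+n (n≤1+n _) , ≤-refl

neighboursIn-far : ∀ π {i k} s → suc k < i ⊎ suc i < k → neighboursIn π (i , s) k ≡ 0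
neighboursIn-far π {i} {k} s far = ∑-zero (π k) (λ _ _ → 𝟙-no _ (apart far ∘ adjacent-columns))
  where
  apart : suc k < i ⊎ suc i < k → ¬ (i ≤ suc k × k ≤ suc i)
  apart (inj₁ 1+k<i) (i≤1+k , _) = <⇒≱ 1+k<i i≤1+k
  apart (inj₂ 1+i<k) (_ , k≤1+i) = <⇒≱ 1+i<k k≤1+i

neighboursIn-beside : ∀ π {i k s} → 1 ≤ s → AbsDiff1 i k → neighboursIn π (i , s) k ≡ 𝟙 (s ≤? π k)
neighboursIn-beside π {i} {k} {s} 1≤s i~k = begin
  ∑ (π k) (λ j → 𝟙 (adjacent? (i , s) (k , j))) ≡⟨ ∑-cong (π k) (λ {j} _ _ → 𝟙-cong _ (j ≟ s) same-row (λ j≡s → inj₂ (i~k , sym j≡s))) ⟩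
  ∑ (π k) (λ j → 𝟙 (j ≟ s))                     ≡⟨ ∑-𝟙-≡ (π k) 1≤s ⟩
  𝟙 (s ≤? π k)                                  ∎
  where
  same-row : ∀ {j} → Adjacent (i , s) (k , j) → j ≡ s
  same-row (inj₁ (refl , _)) = ⊥-elim (AbsDiff1-irrefl i i~k)
  same-row (inj₂ (_ , s≡j))  = sym s≡j

neighboursIn-same : ∀ π i {s} → s ≤ π i → neighboursIn π (i , s) i ≡ 𝟙 (2 ≤? s) + 𝟙 (s <? π i)
neighboursIn-same π i {s} s≤b = begin
  ∑ b (λ j → 𝟙 (adjacent? (i , s) (i , j)))         ≡⟨ ∑-cong b (λ {j} _ _ → 𝟙-cong _ (absDiff1? s j) vertical (λ s~j → inj₁ (refl , s~j))) ⟩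
  ∑ b (λ j → 𝟙 (absDiff1? s j))                     ≡⟨ ∑-cong b (λ {j} _ _ → 𝟙-⊎ (s ≟ suc j) (j ≟ suc s) not-both) ⟩
  ∑ b (λ j → 𝟙 (s ≟ suc j) + 𝟙 (j ≟ suc s))          ≡⟨ ∑-+ b _ _ ⟩
  ∑ b (λ j → 𝟙 (s ≟ suc j)) + ∑ b (λ j → 𝟙 (j ≟ suc s)) ≡⟨ cong₂ _+_ (∑-𝟙-≡suc b s≤b) (∑-𝟙-≡ b (s≤s z≤n)) ⟩
  𝟙 (2 ≤? s) + 𝟙 (s <? b)                           ∎
  where
  b : ℕ
  b = π i
  vertical : ∀ {j} → Adjacent (i , s) (i , j) → AbsDiff1 s j
  vertical (inj₁ (_ , s~j)) = s~j
  vertical (inj₂ (i~i , _)) = ⊥-elim (AbsDiff1-irrefl i i~i)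
  not-both : ∀ {j} → ¬ (s ≡ suc j × j ≡ suc s)
  not-both (s≡1+j , j≡1+s) = <-asym (≤-reflexive (sym s≡1+j)) (≤-reflexive (sym j≡1+s))

degree-interior : ∀ {n i} π {s} → 2 ≤ i → i < n → 1 ≤ s → s ≤ π i →
                  degree n π (i , s) ≡ 𝟙 (s ≤? π (i ∸ 1)) + 𝟙 (2 ≤? s) + 𝟙 (s <? π i) + 𝟙 (s ≤? π (i + 1))
degree-interior {i = suc (suc p)} π {s} (s≤s (s≤s z≤n)) i<n 1≤s s≤b with m≤n⇒∃[o]m+o≡n i<n
... | r , refl rewrite +-comm p 1 = begin
  degree (3 + p + r) π (2 + p , s)
    ≡⟨ degree≡∑-neighboursIn (3 + p + r) π (2 + p , s) ⟩
  ∑ (3 + p + r) N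
    ≡⟨ ∑-split (3 + p) r N ⟩
  ∑ p N + N (1 + p) + N (2 + p) + N (3 + p) + ∑ r (λ j → N (3 + p + j))
    ≡⟨ cong₂ _+_ (cong₂ _+_ (cong₂ _+_ (cong₂ _+_ (∑-zero p (λ _ k≤p → neighboursIn-far π s (inj₁ (s≤s (s≤s k≤p)))))
                                                 (neighboursIn-beside π 1≤s (inj₁ refl)))
                                      (neighboursIn-same π (2 + p) s≤b))
                           (neighboursIn-beside π 1≤s (inj₂ refl)))
                 (∑-zero r (λ 1≤j _ → neighboursIn-far π s (inj₂ (m<m+n (3 + p) 1≤j)))) ⟩
  0 + left + (below + above) + right + 0
    ≡⟨ +-identityʳ _ ⟩
  left + (below + above) + right
    ≡⟨ cong (_+ right) (+-assoc left below above) ⟨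
  left + below + above + right
    ∎
  where
  N : ℕ → ℕ
  N = neighboursIn π (2 + p , s)
  left below above right : ℕ
  left  = 𝟙 (s ≤? π (1 + p))
  below = 𝟙 (2 ≤? s)
  above = 𝟙 (s <? π (2 + p))
  right = 𝟙 (s ≤? π (3 + p))

𝟙-degree≡4-interior : ∀ {n i} π {s} → 2 ≤ i → i < n → 1 ≤ s → s ≤ π i →
                      𝟙 (degree n π (i , s) ≟ 4) ≡ 𝟙 (2 ≤? s ×-dec s ≤? π (i ∸ 1) ⊓ (π (i + 1) ⊓ (π i ∸ 1)))
𝟙-degree≡4-interior {n} {i} π {s} 2≤i i<n 1≤s s≤b = begin
  𝟙 (degree n π (i , s) ≟ 4)            ≡⟨ cong (λ d → 𝟙 (d ≟ 4)) (degree-interior π 2≤i i<n 1≤s s≤b) ⟩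
  𝟙 (𝟙 a? + 𝟙 b? + 𝟙 c? + 𝟙 d? ≟ 4)    ≡⟨ 𝟙-sum≡4 a? b? c? d? ⟩
  𝟙 (a? ×-dec b? ×-dec c? ×-dec d?)     ≡⟨ 𝟙-cong _ (2 ≤? s ×-dec s ≤? K) all-four⇒interval interval⇒all-four ⟩
  𝟙 (2 ≤? s ×-dec s ≤? K)               ∎
  where
  K : ℕ
  K = π (i ∸ 1) ⊓ (π (i + 1) ⊓ (π i ∸ 1))
  a? : Dec (s ≤ π (i ∸ 1))
  a? = s ≤? π (i ∸ 1)
  b? : Dec (2 ≤ s)
  b? = 2 ≤? s
  c? : Dec (s < π i)
  c? = s <? π i
  d? : Dec (s ≤ π (i + 1))
  d? = s ≤? π (i + 1)
  all-four⇒interval : s ≤ π (i ∸ 1) × 2 ≤ s × s < π i × s ≤ π (i + 1) → 2 ≤ s × s ≤ K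
  all-four⇒interval (s≤a , 2≤s , s<b , s≤c) = 2≤s , ⊓-glb s≤a (⊓-glb s≤c (<⇒≤pred s<b))
  interval⇒all-four : 2 ≤ s × s ≤ K → s ≤ π (i ∸ 1) × 2 ≤ s × s < π i × s ≤ π (i + 1)
  interval⇒all-four (2≤s , s≤K) =
      ≤-trans s≤K (m⊓n≤m _ _)
    , 2≤s
    , m≤pred[n]⇒suc[m]≤n {{>-nonZero (≤-trans 1≤s s≤b)}} (≤-trans s≤K (≤-trans (m⊓n≤n _ _) (m⊓n≤n _ _)))
    , ≤-trans s≤K (≤-trans (m⊓n≤n _ _) (m⊓n≤m _ _))

-- The count only involves the heights of columns i - 1, i, i + 1.
corollary2p3 : (n : ℕ) (π : ℕ → ℕ) → IsPermutation n π →
    (i : ℕ) → 2 ≤ i → i ≤ n ∸ 1 →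
    deg4InColumn n π i ≡ 0 ⊔ ((π (i ∸ 1) ⊓ (π (i + 1) ⊓ (π i ∸ 1))) ∸ 1)
corollary2p3 zero    _ _ _ (s≤s (s≤s _)) ()
corollary2p3 (suc n) π _ i 2≤i i≤n = begin
  deg4InColumn (suc n) π i                         ≡⟨ count-range1 (λ s → degree (suc n) π (i , s) ≟ 4) b ⟩
  ∑ b (λ s → 𝟙 (degree (suc n) π (i , s) ≟ 4))     ≡⟨ ∑-cong b (𝟙-degree≡4-interior π 2≤i (s≤s i≤n)) ⟩
  ∑ b (λ s → 𝟙 (2 ≤? s ×-dec s ≤? K))              ≡⟨ ∑-𝟙-×-≤ (2 ≤?_) K≤b ⟩
  ∑ K (λ s → 𝟙 (2 ≤? s))                           ≡⟨ ∑-𝟙-2≤ K ⟩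
  K ∸ 1                                            ∎
  where
  b K : ℕ
  b = π i
  K = π (i ∸ 1) ⊓ (π (i + 1) ⊓ (b ∸ 1))
  K≤b : K ≤ b
  K≤b = ≤-trans (m⊓n≤n _ _) (≤-trans (m⊓n≤n _ _) (m∸n≤m b 1))
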